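{- Let $k\ge 2$, $d\ge 1$ and $N\ge1$ be integers and let $K$ be a $(k,d,N)$-full oriented graph. If $G$ is an oriented graph with $\chi_2(G)\le k$ and degeneracy $d(G)\le d$, then there is an oriented homomorphism from $G$ to $K$.
   Context: An oriented graph is a directed graph whose underlying graph is simple; the degeneracy $d(G)$ is the smallest integer $k$ such that every subgraph of the underlying graph has minimum degree at most $k$. A 2-dipath colouring of $G$ is a proper colouring $c$ of the underlying graph such that whenever $(u,v),(v,w)$ are arcs, $c(u)\ne c(w)$; $\chi_2(G)$ is the least number of colours in a 2-dipath colouring. An oriented homomorphism from $G$ to $K$ is a map $h:V(G)\to V(K)$ with $(h(u),h(v))$ an arc of $K$ for every arc $(u,v)$ of $G$. For an oriented graph $K$ with vertices ordered in a fixed way, a vertex $v$ and a set $A=\{u_1,\dots,u_{|A|}\}$ of neighbours of $v$ (in that order), $F(A,v,K)\in\{ -1,1\}^{|A|}$ has $i$-th entry $1$ if $(v,u_i)$ is an arc and $-1$ if $(u_i,v)$ is an arc. An orientation $K$ of the complete $k$-partite graph with parts $P_1,\dots,P_k$ each of size $N$ is $(k,t,N)$-full if for every $i\in\{1,\dots,k\}$, every $A\subseteq\bigcup_{j\ne i}P_j$ with $|A|\le t$ and every $\vec a\in\{ -1,1\}^{|A|}$, there is a vertex $v\in P_i$ with $F(A,v,K)=\vec a$. -}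

module Defs where

open import Data.Nat using (ℕ; _≤_)
open import Data.Bool using (Bool; true; false; _∨_)
open import Data.Fin using (Fin)
open import Data.Fin.Subset using (Subset; _∈_; _∩_; ∣_∣; Nonempty)
open import Data.Vec using (Vec; tabulate)
import Data.Vec as Vec
open import Data.List using (List; length; lookup)
open import Data.List.Relation.Unary.All using (All)
open import Data.List.Relation.Unary.Unique.Propositional using (Unique)
open import Data.Product using (_×_; _,_; proj₁; ∃; Σ)
open import Data.Sum using (_⊎_)
open import Relation.Binary.PropositionalEquality using (_≡_; _≢_)
open import Relation.Nullary using (¬_)

record OrientedGraph (V : Set) : Set where
  field
    arc     : V → V → Bool
    irrefl  : ∀ u → arc u u ≡ false
    antisym : ∀ u v → arc u v ≡ true → arc v u ≡ false

open OrientedGraph public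

Arc : ∀ {V} → OrientedGraph V → V → V → Set
Arc G u v = arc G u v ≡ true

adj : ∀ {V} → OrientedGraph V → V → V → Bool
adj G u v = arc G u v ∨ arc G v u

Adj : ∀ {V} → OrientedGraph V → V → V → Set
Adj G u v = adj G u v ≡ true

nbhd : ∀ {n} → OrientedGraph (Fin n) → Fin n → Subset n
nbhd G v = tabulate (λ u → adj G u v)

-- degeneracy ≤ d : every (nonempty) subgraph of the underlying graph has
-- a vertex of degree ≤ d.  It suffices (and is equivalent) to quantify
-- over induced subgraphs, given by nonempty vertex subsets S.
DegeneracyAtMost : ∀ {n} → OrientedGraph (Fin n) → ℕ → Set
DegeneracyAtMost {n} G d =
  (S : Subset n) → Nonempty S → ∃ λ v → v ∈ S × ∣ S ∩ nbhd G v ∣ ≤ d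

Is2DipathColouring : ∀ {n k} → OrientedGraph (Fin n) → (Fin n → Fin k) → Set
Is2DipathColouring G c =
  (∀ u v → Adj G u v → c u ≢ c v) ×
  (∀ u v w → Arc G u v → Arc G v w → c u ≢ c w)

Chi2AtMost : ∀ {n} → OrientedGraph (Fin n) → ℕ → Set
Chi2AtMost G k = Σ (_ → Fin k) (λ c → Is2DipathColouring G c)

IsOrientedHom : ∀ {V W} → OrientedGraph V → OrientedGraph W → (V → W) → Set
IsOrientedHom G K h = ∀ u v → Arc G u v → Arc K (h u) (h v)

-- Vertex set of a complete k-partite graph with parts P_1..P_k of size N:
-- vertex (i , j) is the j-th vertex of part P_i.
PVertex : ℕ → ℕ → Set
PVertex k N = Fin k × Fin N

IsCompleteMultipartiteOrientation : ∀ {k N} → OrientedGraph (PVertex k N) → Set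
IsCompleteMultipartiteOrientation K =
  (∀ x y → proj₁ x ≡ proj₁ y → arc K x y ≡ false) ×
  (∀ x y → proj₁ x ≢ proj₁ y → Adj K x y)

data Sign : Set where
  plus minus : Sign

-- F(A,v,K) = a, with A given as a duplicate-free list u_1,...,u_|A|
FEq : ∀ {V} → OrientedGraph V → (A : List V) → V → Vec Sign (length A) → Set
FEq K A v a = ∀ m →
  (Vec.lookup a m ≡ plus  → Arc K v (lookup A m)) ×
  (Vec.lookup a m ≡ minus → Arc K (lookup A m) v)

Full : (k t N : ℕ) → OrientedGraph (PVertex k N) → Set
Full k t N K =
  IsCompleteMultipartiteOrientation K ×
  ((i : Fin k) (A : List (PVertex k N)) → Unique A → length A ≤ t →
   All (λ u → proj₁ u ≢ i) A → (a : Vec Sign (length A)) →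
   ∃ λ (j : Fin N) → FEq K A (i , j) a)

-- Remove the vertices of G one at a time, each time taking a vertex v with
-- at most d neighbours among those remaining; by induction the remaining
-- graph maps to K with every u sent into the part P_{c(u)}.  Put v into
-- P_{c(v)}: the images of its (at most d) remaining neighbours lie outside
-- that part because c is proper, so fullness yields a vertex of P_{c(v)}
-- with any prescribed orientation towards them.  The prescription is
-- consistent: a vertex of K that was the image of both an in- and an
-- out-neighbour w, w' of v would force c(w) = c(w') although w → v → w'
-- is a 2-dipath.
module Submission where

open import Defs
open import Data.Nat using (ℕ; suc; _≤_)
open import Data.Nat.Properties using (≤-trans; ≤-reflexive)
open import Data.Fin using (Fin; zero; suc; _≟_)
open import Data.Fin.Subset using (Subset; _∈_; _∩_; _-_; _⊂_; ∣_∣; ⊤)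
open import Data.Fin.Subset.Properties
  using (nonempty?; ∈⊤; x∈p∩q⁺; x∈p∩q⁻; x∈p∧x≢y⇒x∈p-y; x∈p⇒p-x⊂p)
open import Data.Fin.Subset.Induction using (Acc; acc; ⊂-wellFounded)
open import Data.Bool using (true; false)
import Data.Bool as Bool
open import Data.Bool.Properties using (∨-zeroʳ)
open import Data.Vec using (Vec; []; _∷_; tabulate)
import Data.Vec as Vec
open import Data.Vec.Properties using (lookup∘tabulate; []=⇒lookup; lookup⇒[]=)
open import Data.List using (List; []; _∷_; length; lookup; map; deduplicate)
open import Data.List.Properties using (length-map; length-deduplicate)
open import Data.List.Membership.Propositional renaming (_∈_ to _∈ₗ_)
open import Data.List.Membership.Propositional.Properties
  using (∈-map⁺; ∈-map⁻; ∈-deduplicate⁺; ∈-deduplicate⁻)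
open import Data.List.Relation.Unary.All as All using (All)
open import Data.List.Relation.Unary.All.Properties using (map⁺; anti-mono)
open import Data.List.Relation.Unary.Any as Any using (Any; here; there; any?; satisfied)
open import Data.List.Relation.Unary.Any.Properties using (lookup-index)
open import Data.List.Relation.Unary.Unique.DecPropositional.Properties using (deduplicate-!)
open import Data.Product using (∃; _×_; _,_; proj₁; proj₂)
open import Data.Product.Properties using (≡-dec)
open import Data.Empty using (⊥-elim)
open import Function using (_∘_)
open import Relation.Nullary using (Dec; yes; no; ¬_; _×-dec_)
open import Relation.Binary using (DecidableEquality)
open import Relation.Binary.PropositionalEquality

private
  variable
    n k N : ℕ

elements : Subset n → List (Fin n)
elements []           = []
elements (true  ∷ p) = zero ∷ map suc (elements p)
elements (false ∷ p) = map suc (elements p)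

length-elements : (p : Subset n) → length (elements p) ≡ ∣ p ∣
length-elements []          = refl
length-elements (true  ∷ p) = cong suc (trans (length-map suc (elements p)) (length-elements p))
length-elements (false ∷ p) = trans (length-map suc (elements p)) (length-elements p)

∈-elements⁺ : {p : Subset n} {x : Fin n} → x ∈ p → x ∈ₗ elements p
∈-elements⁺ {p = true  ∷ p} Vec.here       = here refl
∈-elements⁺ {p = true  ∷ p} (Vec.there x∈) = there (∈-map⁺ suc (∈-elements⁺ x∈))
∈-elements⁺ {p = false ∷ p} (Vec.there x∈) = ∈-map⁺ suc (∈-elements⁺ x∈)

∈-elements⁻ : (p : Subset n) {x : Fin n} → x ∈ₗ elements p → x ∈ p
∈-elements⁻ (true  ∷ p) (here refl) = Vec.here
∈-elements⁻ (true  ∷ p) (there x∈) with ∈-map⁻ suc x∈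
... | y , y∈ , refl = Vec.there (∈-elements⁻ p y∈)
∈-elements⁻ (false ∷ p) x∈ with ∈-map⁻ suc x∈
... | y , y∈ , refl = Vec.there (∈-elements⁻ p y∈)

module _ (G : OrientedGraph (Fin n)) where

  ∈-nbhd⁺ : ∀ {u v} → Adj G u v → u ∈ nbhd G v
  ∈-nbhd⁺ {u} {v} a = lookup⇒[]= u _ (trans (lookup∘tabulate (λ u → adj G u v) u) a)

  ∈-nbhd⁻ : ∀ {u v} → u ∈ nbhd G v → Adj G u v
  ∈-nbhd⁻ {u} {v} u∈ = trans (sym (lookup∘tabulate (λ u → adj G u v) u)) ([]=⇒lookup u∈)

module _ {V : Set} (G : OrientedGraph V) where

  ¬Arc-refl : ∀ {v} → ¬ Arc G v v
  ¬Arc-refl {v} a with () ← trans (sym a) (irrefl G v)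

  Arc⇒Adj : ∀ {u v} → Arc G u v → Adj G u v
  Arc⇒Adj a rewrite a = refl

  Arc⇒Adj˘ : ∀ {u v} → Arc G v u → Adj G u v
  Arc⇒Adj˘ {u} {v} a rewrite a = ∨-zeroʳ (arc G u v)

SignedArc : ∀ {V} → OrientedGraph V → V → V → Sign → Set
SignedArc G v x plus  = Arc G v x
SignedArc G v x minus = Arc G x v

SignedArc⇒Adj : ∀ {V} (G : OrientedGraph V) {v x} s → SignedArc G v x s → Adj G x v
SignedArc⇒Adj G plus  a = Arc⇒Adj˘ G a
SignedArc⇒Adj G minus a = Arc⇒Adj G a

FEq⇒SignedArc : ∀ {V} {K : OrientedGraph V} {A v a} → FEq K A v a →
                ∀ m → SignedArc K v (lookup A m) (Vec.lookup a m)
FEq⇒SignedArc {a = a} F m with Vec.lookup a m | F m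
... | plus  | toward , _ = toward refl
... | minus | _ , from   = from refl

_≟ᵥ_ : DecidableEquality (PVertex k N)
_≟ᵥ_ = ≡-dec _≟_ _≟_

-- Deduplicating B is harmless because the prescribed signs are a function of the vertex.
Full⇒realises : ∀ {k t N} {K : OrientedGraph (PVertex k N)} → Full k t N K →
                (i : Fin k) (B : List (PVertex k N)) → length B ≤ t →
                All (λ x → proj₁ x ≢ i) B → (σ : PVertex k N → Sign) →
                ∃ λ j → ∀ {x} → x ∈ₗ B → SignedArc K (i , j) x (σ x)
Full⇒realises {k} {t} {N} {K} (_ , full) i B |B|≤t B-outside σ = j , realised
  where
  A : List (PVertex k N)
  A = deduplicate _≟ᵥ_ B

  a : Vec Sign (length A)
  a = tabulate (σ ∘ lookup A)

  A-realised : ∃ λ j → FEq K A (i , j) a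
  A-realised = full i A (deduplicate-! _≟ᵥ_ B) (≤-trans (length-deduplicate _≟ᵥ_ B) |B|≤t)
                    (anti-mono (∈-deduplicate⁻ _≟ᵥ_ B) B-outside) a

  j : Fin N
  j = proj₁ A-realised

  realised : ∀ {x} → x ∈ₗ B → SignedArc K (i , j) x (σ x)
  realised x∈B with ∈-deduplicate⁺ _≟ᵥ_ x∈B
  ... | x∈A with m ← Any.index x∈A | refl ← lookup-index x∈A =
    subst (SignedArc K (i , j) (lookup A m)) (lookup∘tabulate (σ ∘ lookup A) m)
          (FEq⇒SignedArc {A = A} {a = a} (proj₂ A-realised) m)

module _ (G : OrientedGraph (Fin n)) (c : Fin n → Fin k)
         (c-2dipath : ∀ u v w → Arc G u v → Arc G v w → c u ≢ c w)
         (h : Fin n → PVertex k N) (h-part : ∀ u → proj₁ (h u) ≡ c u)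
         (v : Fin n) (L : List (Fin n)) where

  OutImage : PVertex k N → Fin n → Set
  OutImage x w = Arc G v w × h w ≡ x

  outImage? : ∀ x → Dec (Any (OutImage x) L)
  outImage? x = any? (λ w → (arc G v w Bool.≟ true) ×-dec (h w ≟ᵥ x)) L

  inducedSign : PVertex k N → Sign
  inducedSign x with outImage? x
  ... | yes _ = plus
  ... | no  _ = minus

  inducedSign-correct : ∀ {w} s → w ∈ₗ L → SignedArc G v w s → inducedSign (h w) ≡ s
  inducedSign-correct {w} plus w∈L v→w with outImage? (h w)
  ... | yes _   = refl
  ... | no none = ⊥-elim (none (Any.map (λ { refl → v→w , refl }) w∈L))
  inducedSign-correct {w} minus w∈L w→v with outImage? (h w)
  ... | no _    = refl
  ... | yes out with satisfied out
  ... | w′ , v→w′ , hw′≡hw = ⊥-elim (c-2dipath w v w′ w→v v→w′ (begin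
    c w           ≡⟨ h-part w ⟨
    proj₁ (h w)   ≡⟨ cong proj₁ hw′≡hw ⟨
    proj₁ (h w′)  ≡⟨ h-part w′ ⟩
    c w′          ∎))
    where open ≡-Reasoning

module Extension {k d N n} {K : OrientedGraph (PVertex k N)} (full : Full k d N K)
                 (G : OrientedGraph (Fin n)) (c : Fin n → Fin k)
                 (c-2dipath : Is2DipathColouring G c) where

  RespectsParts : (Fin n → PVertex k N) → Set
  RespectsParts φ = ∀ u → proj₁ (φ u) ≡ c u

  record PartRespectingHomOn (S : Subset n) : Set where
    field
      φ      : Fin n → PVertex k N
      φ-part : RespectsParts φ
      φ-hom  : ∀ {u w} → u ∈ S → w ∈ S → Arc G u w → Arc K (φ u) (φ w)

  placement : ∀ S v → ∣ S ∩ nbhd G v ∣ ≤ d → (ψ : Fin n → PVertex k N) → RespectsParts ψ →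
              ∃ λ j → ∀ {w} s → w ∈ S → SignedArc G v w s → SignedArc K (c v , j) (ψ w) s
  placement S v deg-v ψ ψ-part = proj₁ realisation , placed
    where
    L : List (Fin n)
    L = elements (S ∩ nbhd G v)

    adj-v : ∀ {w} → w ∈ₗ L → Adj G w v
    adj-v w∈L = ∈-nbhd⁻ G (proj₂ (x∈p∩q⁻ S (nbhd G v) (∈-elements⁻ _ w∈L)))

    images-outside : All (λ x → proj₁ x ≢ c v) (map ψ L)
    images-outside = map⁺ (All.tabulate λ {w} w∈L ψw∈Pᵥ →
      proj₁ c-2dipath w v (adj-v w∈L) (trans (sym (ψ-part w)) ψw∈Pᵥ))

    |images|≤d : length (map ψ L) ≤ d
    |images|≤d = ≤-trans (≤-reflexive (trans (length-map ψ L) (length-elements (S ∩ nbhd G v))))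
                         deg-v

    σ : PVertex k N → Sign
    σ = inducedSign G c (proj₂ c-2dipath) ψ ψ-part v L

    realisation : ∃ λ j → ∀ {x} → x ∈ₗ map ψ L → SignedArc K (c v , j) x (σ x)
    realisation = Full⇒realises full (c v) (map ψ L) |images|≤d images-outside σ

    placed : ∀ {w} s → w ∈ S → SignedArc G v w s → SignedArc K (c v , proj₁ realisation) (ψ w) s
    placed {w} s w∈S v-w = subst (SignedArc K (c v , proj₁ realisation) (ψ w))
      (inducedSign-correct G c (proj₂ c-2dipath) ψ ψ-part v L s w∈L v-w)
      (proj₂ realisation (∈-map⁺ ψ w∈L))
      where
      w∈L : w ∈ₗ L
      w∈L = ∈-elements⁺ (x∈p∩q⁺ (w∈S , ∈-nbhd⁺ G (SignedArc⇒Adj G s v-w)))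

  extend : ∀ {S v} → v ∈ S → ∣ S ∩ nbhd G v ∣ ≤ d →
           PartRespectingHomOn (S - v) → PartRespectingHomOn S
  extend {S} {v} v∈S deg-v ψ = record { φ = φ ; φ-part = φ-part ; φ-hom = φ-hom }
    where
    open PartRespectingHomOn ψ renaming (φ to ψ₀; φ-part to ψ-part; φ-hom to ψ-hom)

    φv : PVertex k N
    φv = c v , proj₁ (placement S v deg-v ψ₀ ψ-part)

    φv-arcs : ∀ {w} s → w ∈ S → SignedArc G v w s → SignedArc K φv (ψ₀ w) s
    φv-arcs = proj₂ (placement S v deg-v ψ₀ ψ-part)

    φ : Fin n → PVertex k N
    φ u with u ≟ v
    ... | yes _ = φv
    ... | no  _ = ψ₀ u

    φ-part : RespectsParts φ
    φ-part u with u ≟ v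
    ... | yes refl = refl
    ... | no  _    = ψ-part u

    φ-hom : ∀ {u w} → u ∈ S → w ∈ S → Arc G u w → Arc K (φ u) (φ w)
    φ-hom {u} {w} u∈S w∈S u→w with u ≟ v | w ≟ v
    ... | yes refl | yes refl = ⊥-elim (¬Arc-refl G u→w)
    ... | yes refl | no  _    = φv-arcs plus w∈S u→w
    ... | no  _    | yes refl = φv-arcs minus u∈S u→w
    ... | no  u≢v  | no  w≢v  = ψ-hom (x∈p∧x≢y⇒x∈p-y u∈S u≢v) (x∈p∧x≢y⇒x∈p-y w∈S w≢v) u→w

  partRespectingHomOn : Fin N → DegeneracyAtMost G d → (S : Subset n) → Acc _⊂_ S →
                        PartRespectingHomOn S
  partRespectingHomOn j₀ deg S (acc smaller) with nonempty? S
  ... | no S-empty = record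
    { φ      = λ u → c u , j₀
    ; φ-part = λ _ → refl
    ; φ-hom  = λ u∈S _ _ → ⊥-elim (S-empty (_ , u∈S)) }
  ... | yes S-nonempty with deg S S-nonempty
  ... | v , v∈S , deg-v =
    extend v∈S deg-v (partRespectingHomOn j₀ deg (S - v) (smaller (x∈p⇒p-x⊂p v∈S)))

lemma10 : (k d N : ℕ) → 2 ≤ k → 1 ≤ d → 1 ≤ N →
          (K : OrientedGraph (PVertex k N)) → Full k d N K →
          (n : ℕ) (G : OrientedGraph (Fin n)) →
          Chi2AtMost G k → DegeneracyAtMost G d →
          ∃ λ (h : Fin n → PVertex k N) → IsOrientedHom G K h
lemma10 k d (suc N) _ _ _ K full n G (c , c-2dipath) deg = φ , λ _ _ → φ-hom ∈⊤ ∈⊤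
  where
  open Extension {K = K} full G c c-2dipath
  open PartRespectingHomOn (partRespectingHomOn zero deg ⊤ (⊂-wellFounded ⊤))
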